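{- Let $G$ be a connected graph of order $n\geq 3$ and diameter $D\geq 2$. Then $\frac{d_k(G)}{d_{k+1}(G)} \geq \frac{2}{n-k-1}$ for all $1\leq k<D$.
   Context: For a connected graph $G$, $d_i(G)$ denotes the number of unordered pairs of vertices of $G$ at distance exactly $i$. -}

module Defs where

open import Data.Nat using (ℕ; zero; suc; _<_)
open import Data.Fin using (Fin; _<?_)
open import Data.Fin.Properties using (_≟_)
open import Data.Bool using (Bool; true; false; _∧_; _∨_; not)
open import Data.Bool.ListAction using (any)
open import Data.List using (List; allFin; length; filterᵇ; concatMap; map)
open import Data.Product using (_×_; _,_; ∃; ∃-syntax; proj₁; proj₂)
open import Relation.Nullary.Decidable using (⌊_⌋)
open import Relation.Binary.PropositionalEquality using (_≡_)

record Graph (n : ℕ) : Set where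
  field
    adj   : Fin n → Fin n → Bool
    sym   : ∀ u v → adj u v ≡ adj v u
    irrefl : ∀ u → adj u u ≡ false
open Graph public

-- within G k u v = true  iff  there is a walk from u to v of length ≤ k,
-- i.e. iff dist(u,v) ≤ k.
within : ∀ {n} → Graph n → ℕ → Fin n → Fin n → Bool
within G zero    u v = ⌊ u ≟ v ⌋
within {n} G (suc k) u v =
  within G k u v ∨ any (λ w → within G k u w ∧ adj G w v) (allFin n)

atDist : ∀ {n} → Graph n → ℕ → Fin n → Fin n → Bool
atDist G zero    u v = within G zero u v
atDist G (suc i) u v = within G (suc i) u v ∧ not (within G i u v)

pairs : (n : ℕ) → List (Fin n × Fin n)
pairs n = concatMap (λ u → map (λ v → (u , v)) (filterᵇ (λ v → ⌊ u <? v ⌋) (allFin n))) (allFin n)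

d : ∀ {n} → ℕ → Graph n → ℕ
d {n} i G = length (filterᵇ (λ p → atDist G i (proj₁ p) (proj₂ p)) (pairs n))

Connected : ∀ {n} → Graph n → Set
Connected G = ∀ u v → ∃[ k ] within G k u v ≡ true

HasDiameter : ∀ {n} → Graph n → ℕ → Set
HasDiameter G D = (∀ u v → within G D u v ≡ true) × (∃[ u ] ∃[ v ] atDist G D u v ≡ true)

module Submission where

-- Count ORDERED pairs instead: N_i = #{(u,v) : dist(u,v) = i} = 2·d_i for i ≥ 1.
--  * Every pair (u,v) at distance k+1 arises from a pair (u,w) at distance k by an edge w–v,
--    so N_{k+1} ≤ Σ_{dist(u,w)=k} out(u,w), where out(u,w) = #{v ~ w : dist(u,v) = k+1};
--    as distance is symmetric, also N_{k+1} ≤ Σ_{dist(u,w)=k} out(w,u).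
--  * For dist(u,w) = k, the vertices counted by out(u,w), by out(w,u), and those within
--    distance k of both u and w are pairwise distinct; the last set contains a shortest u–w
--    path, hence has ≥ k+1 elements, so out(u,w) + out(w,u) ≤ n − k − 1.
-- Adding the two bounds gives 2·N_{k+1} ≤ (n − k − 1)·N_k.

open import Defs hiding (sym)
open import Data.Nat using (ℕ; zero; suc; _+_; _*_; _∸_; _≤_; _<_; _≤′_; ≤′-refl; ≤′-step; z≤n)
open import Data.Nat.Properties
  using ( ≤-refl; ≤-trans; ≤-reflexive; +-mono-≤; +-comm; +-identityʳ; m≤m+n; m≤n+m; n≤1+n
        ; m∸n≤m; m∸n+n≡m; ∸-+-assoc; ∸-monoʳ-≤; m+n≤o⇒m≤o∸n; *-cancelˡ-≤; *-identityˡ; *-identityʳ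
        ; ≤⇒≤′; +-*-semiring; *-commutativeSemigroup; module ≤-Reasoning )
open import Data.Bool using (Bool; true; false; T; _∧_; not)
open import Data.Bool.Properties using (T-∧; T-∨; T-not-≡)
open import Data.Fin using (Fin; _<?_) renaming (zero to fzero; suc to fsuc)
open import Data.Fin.Properties using (<-cmp)
open import Data.List using (List; []; _∷_; _++_; length; filterᵇ; map; concatMap; tabulate; allFin)
open import Data.List.Relation.Unary.Any using (satisfied)
open import Data.List.Relation.Unary.Any.Properties using (any⁺; any⁻)
open import Data.List.Membership.Propositional using (lose)
open import Data.List.Membership.Propositional.Properties using (∈-allFin)
open import Data.Product using (_×_; _,_; proj₁; proj₂; ∃-syntax)
open import Data.Sum using (_⊎_; inj₁; inj₂)
open import Data.Empty using (⊥; ⊥-elim)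
open import Data.Unit using (tt)
open import Function using (_∘_; id; Equivalence)
open import Relation.Nullary using (¬_)
open import Relation.Nullary.Decidable using (⌊_⌋; does; toWitness; fromWitness; isYes≗does; dec-true; dec-false)
open import Relation.Binary using (tri<; tri≈; tri>)
open import Relation.Binary.PropositionalEquality
  using (_≡_; refl; sym; trans; cong; cong₂; subst; module ≡-Reasoning)
open import Algebra.Properties.Semiring.Sum +-*-semiring
  using (sum; sum-syntax; ∑-distrib-+; ∑-comm; *-distribˡ-sum; sum-cong-≗)
open import Algebra.Properties.CommutativeSemigroup *-commutativeSemigroup using (x∙yz≈y∙xz)

ι : Bool → ℕ
ι true  = 1
ι false = 0

ι-true : ∀ {b} → T b → ι b ≡ 1
ι-true {true} _ = refl

T-ext : ∀ {a b} → (T a → T b) → (T b → T a) → a ≡ b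
T-ext {false} {false} _   _   = refl
T-ext {false} {true}  _   b⇒a = ⊥-elim (b⇒a tt)
T-ext {true}  {false} a⇒b _   = ⊥-elim (a⇒b tt)
T-ext {true}  {true}  _   _   = refl

¬T⇒≡false : ∀ {b} → ¬ T b → b ≡ false
¬T⇒≡false {false} _  = refl
¬T⇒≡false {true}  ¬b = ⊥-elim (¬b tt)

first : ∀ {a b} → T (a ∧ b) → T a
first = proj₁ ∘ Equivalence.to T-∧

second : ∀ {a b} → T (a ∧ b) → T b
second = proj₂ ∘ Equivalence.to T-∧

both : ∀ {a b} → T a → T b → T (a ∧ b)
both p q = Equivalence.from T-∧ (p , q)

ι-exclusive₂ : ∀ a b c → (T a → T c) → (T b → T c) → (T a → T b → ⊥) → ι a + ι b ≤ ι c
ι-exclusive₂ false false c _  _  _    = z≤n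
ι-exclusive₂ false true  c _  b⇒c _   = ≤-reflexive (sym (ι-true (b⇒c tt)))
ι-exclusive₂ true  false c a⇒c _ _    = ≤-reflexive (sym (ι-true (a⇒c tt)))
ι-exclusive₂ true  true  c _  _  a#b  = ⊥-elim (a#b tt tt)

ι-exclusive₃ : ∀ a b c → (T a → T b → ⊥) → (T a → T c → ⊥) → (T b → T c → ⊥) → ι a + ι b + ι c ≤ 1
ι-exclusive₃ false false false _   _   _   = z≤n
ι-exclusive₃ false false true  _   _   _   = ≤-refl
ι-exclusive₃ false true  false _   _   _   = ≤-refl
ι-exclusive₃ false true  true  _   _   b#c = ⊥-elim (b#c tt tt)
ι-exclusive₃ true  false false _   _   _   = ≤-refl
ι-exclusive₃ true  false true  _   a#c _   = ⊥-elim (a#c tt tt)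
ι-exclusive₃ true  true  c     a#b _   _   = ⊥-elim (a#b tt tt)

ι≤ : ∀ b {m} → (T b → 1 ≤ m) → ι b ≤ m
ι≤ false _   = z≤n
ι≤ true  1≤m = 1≤m tt

ι-weighted : ∀ b {x y} c → (T b → x + y ≤ c) → ι b * x + ι b * y ≤ c * ι b
ι-weighted false     c _     = z≤n
ι-weighted true {x} {y} c x+y≤c = begin
    1 * x + 1 * y ≡⟨ cong₂ _+_ (*-identityˡ x) (*-identityˡ y) ⟩
    x + y         ≤⟨ x+y≤c tt ⟩
    c             ≡⟨ sym (*-identityʳ c) ⟩
    c * 1         ∎
  where open ≤-Reasoning

sum-mono-≤ : ∀ {n} {f g : Fin n → ℕ} → (∀ i → f i ≤ g i) → sum f ≤ sum g
sum-mono-≤ {zero}  f≤g = z≤n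
sum-mono-≤ {suc n} f≤g = +-mono-≤ (f≤g fzero) (sum-mono-≤ (f≤g ∘ fsuc))

term≤sum : ∀ {n} (f : Fin n → ℕ) i → f i ≤ sum f
term≤sum f fzero    = m≤m+n _ _
term≤sum f (fsuc i) = ≤-trans (term≤sum (f ∘ fsuc) i) (m≤n+m _ (f fzero))

sum-hit : ∀ {n} (f : Fin n → ℕ) i → f i ≡ 1 → 1 ≤ sum f
sum-hit f i fi≡1 = ≤-trans (≤-reflexive (sym fi≡1)) (term≤sum f i)

sum-ones : ∀ n → ∑[ i < n ] 1 ≡ n
sum-ones zero    = refl
sum-ones (suc n) = cong suc (sum-ones n)

count : ∀ {A : Set} → (A → Bool) → List A → ℕ
count p xs = length (filterᵇ p xs)

count-++ : ∀ {A : Set} (p : A → Bool) xs ys → count p (xs ++ ys) ≡ count p xs + count p ys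
count-++ p []       ys = refl
count-++ p (x ∷ xs) ys with p x
... | true  = cong suc (count-++ p xs ys)
... | false = count-++ p xs ys

count-map : ∀ {A B : Set} (p : B → Bool) (f : A → B) xs → count p (map f xs) ≡ count (p ∘ f) xs
count-map p f []       = refl
count-map p f (x ∷ xs) with p (f x)
... | true  = cong suc (count-map p f xs)
... | false = count-map p f xs

count-filterᵇ : ∀ {A : Set} (p q : A → Bool) xs → count p (filterᵇ q xs) ≡ count (λ x → q x ∧ p x) xs
count-filterᵇ p q []       = refl
count-filterᵇ p q (x ∷ xs) with q x
... | false = count-filterᵇ p q xs
... | true with p x
...   | true  = cong suc (count-filterᵇ p q xs)
...   | false = count-filterᵇ p q xs

count-tabulate : ∀ {A : Set} {n} (p : A → Bool) (f : Fin n → A) → count p (tabulate f) ≡ ∑[ i < n ] ι (p (f i))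
count-tabulate {n = zero}  p f = refl
count-tabulate {n = suc n} p f with p (f fzero)
... | true  = cong suc (count-tabulate p (f ∘ fsuc))
... | false = count-tabulate p (f ∘ fsuc)

count-concatMap : ∀ {A B : Set} {n} (p : B → Bool) (h : A → List B) (f : Fin n → A) →
  count p (concatMap h (tabulate f)) ≡ ∑[ i < n ] count p (h (f i))
count-concatMap {n = zero}  p h f = refl
count-concatMap {n = suc n} p h f =
  trans (count-++ p (h (f fzero)) _) (cong (count p (h (f fzero)) +_) (count-concatMap p h (f ∘ fsuc)))

count-pairs : ∀ n (p : Fin n × Fin n → Bool) →
  count p (pairs n) ≡ ∑[ u < n ] ∑[ v < n ] ι (⌊ u <? v ⌋ ∧ p (u , v))
count-pairs n p = trans (count-concatMap p row id) (sum-cong-≗ λ u → begin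
    count p (row u)
      ≡⟨ count-map p (u ,_) (filterᵇ (λ v → ⌊ u <? v ⌋) (allFin n)) ⟩
    count (λ v → p (u , v)) (filterᵇ (λ v → ⌊ u <? v ⌋) (allFin n))
      ≡⟨ count-filterᵇ (λ v → p (u , v)) (λ v → ⌊ u <? v ⌋) (allFin n) ⟩
    count (λ v → ⌊ u <? v ⌋ ∧ p (u , v)) (allFin n)
      ≡⟨ count-tabulate (λ v → ⌊ u <? v ⌋ ∧ p (u , v)) id ⟩
    ∑[ v < n ] ι (⌊ u <? v ⌋ ∧ p (u , v)) ∎)
  where
  open ≡-Reasoning
  row : Fin n → List (Fin n × Fin n)
  row u = map (u ,_) (filterᵇ (λ v → ⌊ u <? v ⌋) (allFin n))

ordered≡2*unordered : ∀ n (r : Fin n → Fin n → Bool) → (∀ u v → r u v ≡ r v u) → (∀ u → r u u ≡ false) →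
  ∑[ u < n ] ∑[ v < n ] ι (r u v) ≡ 2 * count (λ q → r (proj₁ q) (proj₂ q)) (pairs n)
ordered≡2*unordered n r r-sym r-irrefl = begin
    ∑[ u < n ] ∑[ v < n ] ι (r u v)
      ≡⟨ sum-cong-≗ (λ u → trans (sum-cong-≗ (split u)) (∑-distrib-+ (below u) (λ v → below v u))) ⟩
    ∑[ u < n ] (∑[ v < n ] below u v + ∑[ v < n ] below v u)
      ≡⟨ ∑-distrib-+ (λ u → ∑[ v < n ] below u v) (λ u → ∑[ v < n ] below v u) ⟩
    U + ∑[ u < n ] ∑[ v < n ] below v u
      ≡⟨ cong (U +_) (∑-comm (λ u v → below v u)) ⟩
    U + U
      ≡⟨ cong (U +_) (sym (+-identityʳ U)) ⟩
    2 * U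
      ≡⟨ cong (2 *_) (sym (count-pairs n _)) ⟩
    2 * count (λ q → r (proj₁ q) (proj₂ q)) (pairs n) ∎
  where
  open ≡-Reasoning
  below : Fin n → Fin n → ℕ
  below u v = ι (⌊ u <? v ⌋ ∧ r u v)
  U : ℕ
  U = ∑[ u < n ] ∑[ v < n ] below u v
  guarded : ∀ u v {a b} → does (u <? v) ≡ a → does (v <? u) ≡ b →
            below u v + below v u ≡ ι (a ∧ r u v) + ι (b ∧ r v u)
  guarded u v p q = cong₂ (λ a b → ι (a ∧ r u v) + ι (b ∧ r v u))
                          (trans (isYes≗does (u <? v)) p) (trans (isYes≗does (v <? u)) q)
  split : ∀ u v → ι (r u v) ≡ below u v + below v u
  split u v with <-cmp u v
  ... | tri< u<v _ v≮u = sym (trans (guarded u v (dec-true (u <? v) u<v) (dec-false (v <? u) v≮u)) (+-identityʳ _))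
  ... | tri> u≮v _ v<u = trans (cong ι (r-sym u v)) (sym (guarded u v (dec-false (u <? v) u≮v) (dec-true (v <? u) v<u)))
  ... | tri≈ u≮u refl _ = trans (cong ι (r-irrefl u)) (sym (guarded u v (dec-false (u <? u) u≮u) (dec-false (u <? u) u≮u)))

module Distances {n : ℕ} (G : Graph n) where

  Near : ℕ → Fin n → Fin n → Set
  Near k u v = T (within G k u v)

  At : ℕ → Fin n → Fin n → Set
  At i u v = T (atDist G i u v)

  Adj : Fin n → Fin n → Set
  Adj u v = T (adj G u v)

  near-zero-refl : ∀ u → Near 0 u u
  near-zero-refl u = fromWitness refl

  near-zero⇒≡ : ∀ {u v} → Near 0 u v → u ≡ v
  near-zero⇒≡ = toWitness

  near-stay : ∀ k {u v} → Near k u v → Near (suc k) u v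
  near-stay k p = Equivalence.from T-∨ (inj₁ p)

  near-extend : ∀ k {u w v} → Near k u w → Adj w v → Near (suc k) u v
  near-extend k {u} {w} {v} p e =
    Equivalence.from T-∨ (inj₂ (any⁺ (λ x → within G k u x ∧ adj G x v) (lose (∈-allFin w) (both p e))))

  near-suc-elim : ∀ k {u v} → Near (suc k) u v → Near k u v ⊎ ∃[ w ] (Near k u w × Adj w v)
  near-suc-elim k {u} {v} p with Equivalence.to T-∨ p
  ... | inj₁ q = inj₁ q
  ... | inj₂ q with satisfied (any⁻ (λ x → within G k u x ∧ adj G x v) (allFin n) q)
  ...   | w , r = inj₂ (w , first r , second r)

  near-prepend : ∀ k {u x v} → Adj u x → Near k x v → Near (suc k) u v
  near-prepend zero {u} e p with near-zero⇒≡ p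
  ... | refl = near-extend 0 (near-zero-refl u) e
  near-prepend (suc k) e p with near-suc-elim k p
  ... | inj₁ q = near-stay (suc k) (near-prepend k e q)
  ... | inj₂ (w , q , f) = near-extend (suc k) (near-prepend k e q) f

  near-sym : ∀ k {u v} → Near k u v → Near k v u
  near-sym zero p with near-zero⇒≡ p
  ... | refl = p
  near-sym (suc k) p with near-suc-elim k p
  ... | inj₁ q = near-stay k (near-sym k q)
  ... | inj₂ (w , q , e) = near-prepend k (subst T (Graph.sym G w _) e) (near-sym k q)

  near-mono : ∀ {k m u v} → k ≤ m → Near k u v → Near m u v
  near-mono k≤m = go (≤⇒≤′ k≤m)
    where
    go : ∀ {k m u v} → k ≤′ m → Near k u v → Near m u v
    go ≤′-refl           p = p
    go (≤′-step {m} k≤m) p = near-stay m (go k≤m p)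

  near-refl : ∀ k u → Near k u u
  near-refl k u = near-mono {0} {k} z≤n (near-zero-refl u)

  adj⇒near : ∀ {k u v} → 1 ≤ k → Adj u v → Near k u v
  adj⇒near {k} {u} 1≤k e = near-mono {1} {k} 1≤k (near-extend 0 (near-zero-refl u) e)

  within-sym : ∀ k u v → within G k u v ≡ within G k v u
  within-sym k u v = T-ext (near-sym k) (near-sym k)

  atDist-sym : ∀ i u v → atDist G i u v ≡ atDist G i v u
  atDist-sym zero    u v = within-sym 0 u v
  atDist-sym (suc i) u v = cong₂ (λ a b → a ∧ not b) (within-sym (suc i) u v) (within-sym i u v)

  at⇒near : ∀ i {u v} → At i u v → Near i u v
  at⇒near zero    p = p
  at⇒near (suc i) p = first p

  at⇒¬near : ∀ i {u v} → At (suc i) u v → ¬ Near i u v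
  at⇒¬near i p = subst T (Equivalence.to T-not-≡ (second p))

  near∧¬near⇒at : ∀ i {u v} → Near (suc i) u v → ¬ Near i u v → At (suc i) u v
  near∧¬near⇒at i p q = both p (Equivalence.from T-not-≡ (¬T⇒≡false q))

  atDist-irrefl : ∀ i u → atDist G (suc i) u u ≡ false
  atDist-irrefl i u = ¬T⇒≡false (λ p → at⇒¬near i p (near-refl i u))

  ordered : ℕ → ℕ
  ordered i = ∑[ u < n ] ∑[ v < n ] ι (atDist G i u v)

  ordered≡2*d : ∀ i → ordered (suc i) ≡ 2 * d (suc i) G
  ordered≡2*d i = ordered≡2*unordered n (atDist G (suc i)) (atDist-sym (suc i)) (atDist-irrefl i)

  predecessor : ∀ i {u v} → At (suc i) u v → ∃[ w ] (At i u w × Adj w v)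
  predecessor i p with near-suc-elim i (at⇒near (suc i) p)
  ... | inj₁ q = ⊥-elim (at⇒¬near i p q)
  predecessor zero    p | inj₂ (w , q , e) = w , q , e
  predecessor (suc i) p | inj₂ (w , q , e) =
    w , near∧¬near⇒at i q (λ r → at⇒¬near (suc i) p (near-extend i r e)) , e

  geodesic-point : ∀ j i {u x} → At (j + i) u x → ∃[ v ] (At i u v × Near j v x)
  geodesic-point zero    i {x = x} p = x , p , near-zero-refl x
  geodesic-point (suc j) i p with predecessor (j + i) p
  ... | y , q , e with geodesic-point j i q
  ...   | v , r , s = v , r , near-extend j s e

  -- If dist(u,w) = K and m ≤ K, then at least m+1 vertices are within m of u and within K
  -- of w: the first m+1 vertices of a shortest u–w path.
  geodesic-ball : ∀ K {u w} → At K u w → ∀ m → m ≤ K →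
    suc m ≤ ∑[ v < n ] ι (within G m u v ∧ within G K w v)
  geodesic-ball K {u} {w} p = go
    where
    layer : ∀ i → i ≤ K → 1 ≤ ∑[ v < n ] ι (atDist G i u v ∧ within G K w v)
    layer i i≤K with geodesic-point (K ∸ i) i (subst (λ j → At j u w) (sym (m∸n+n≡m i≤K)) p)
    ... | v , q , r =
      sum-hit (λ v → ι (atDist G i u v ∧ within G K w v)) v
              (ι-true (both q (near-sym K (near-mono (m∸n≤m K i) r))))
    go : ∀ m → m ≤ K → suc m ≤ ∑[ v < n ] ι (within G m u v ∧ within G K w v)
    go zero    _    = layer 0 z≤n
    go (suc m) m+1≤K = begin
        suc (suc m)
          ≡⟨ +-comm 1 (suc m) ⟩
        suc m + 1
          ≤⟨ +-mono-≤ (go m (≤-trans (n≤1+n m) m+1≤K)) (layer (suc m) m+1≤K) ⟩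
        ∑[ v < n ] inner v + ∑[ v < n ] rim v
          ≡⟨ sym (∑-distrib-+ inner rim) ⟩
        ∑[ v < n ] (inner v + rim v)
          ≤⟨ sum-mono-≤ (λ v → ι-exclusive₂ (within G m u v ∧ within G K w v)
               (atDist G (suc m) u v ∧ within G K w v) (within G (suc m) u v ∧ within G K w v)
               (λ a → both (near-stay m (first a)) (second a))
               (λ b → both (at⇒near (suc m) (first b)) (second b))
               (λ a b → at⇒¬near m (first b) (first a))) ⟩
        ∑[ v < n ] ι (within G (suc m) u v ∧ within G K w v) ∎
      where
      open ≤-Reasoning
      inner rim : Fin n → ℕ
      inner v = ι (within G m u v ∧ within G K w v)
      rim   v = ι (atDist G (suc m) u v ∧ within G K w v)

module DoubleCounting {n : ℕ} (G : Graph n) (K : ℕ) where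
  open Distances G

  overDistK : (Fin n → Fin n → ℕ) → ℕ
  overDistK f = ∑[ u < n ] ∑[ w < n ] (ι (atDist G K u w) * f u w)

  outward : Fin n → Fin n → ℕ
  outward u w = ∑[ v < n ] ι (adj G w v ∧ atDist G (suc K) u v)

  -- Every pair at distance K+1 arises by stepping outward from a pair at distance K.
  ordered≤outward : ordered (suc K) ≤ overDistK outward
  ordered≤outward = begin
      ordered (suc K)
        ≤⟨ sum-mono-≤ (λ u → sum-mono-≤ (λ v → ι≤ (atDist G (suc K) u v) (reach u v))) ⟩
      ∑[ u < n ] ∑[ v < n ] ∑[ w < n ] step u w v
        ≡⟨ sum-cong-≗ (λ u → ∑-comm (λ v w → step u w v)) ⟩
      ∑[ u < n ] ∑[ w < n ] ∑[ v < n ] step u w v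
        ≡⟨ sum-cong-≗ (λ u → sum-cong-≗ (λ w → sym (*-distribˡ-sum (ι (atDist G K u w)) (edge u w)))) ⟩
      overDistK outward ∎
    where
    open ≤-Reasoning
    edge step : Fin n → Fin n → Fin n → ℕ
    edge u w v = ι (adj G w v ∧ atDist G (suc K) u v)
    step u w v = ι (atDist G K u w) * edge u w v
    reach : ∀ u v → At (suc K) u v → 1 ≤ ∑[ w < n ] step u w v
    reach u v p with predecessor K p
    ... | w , q , e = sum-hit (λ w → step u w v) w (cong₂ _*_ (ι-true q) (ι-true (both e p)))

  outward-swap : overDistK outward ≡ overDistK (λ u w → outward w u)
  outward-swap = trans (∑-comm (λ u w → ι (atDist G K u w) * outward u w))
                       (sum-cong-≗ λ u → sum-cong-≗ λ w → cong (λ b → ι b * outward w u) (atDist-sym K w u))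

  -- For dist(u,w) = K ≥ 1, the vertices counted by outward u w, by outward w u, and the at
  -- least K+1 vertices within K of both u and w are pairwise distinct.
  outward-bound : 1 ≤ K → ∀ {u w} → At K u w → outward u w + outward w u ≤ n ∸ K ∸ 1
  outward-bound 1≤K {u} {w} p = begin
      outward u w + outward w u ≤⟨ m+n≤o⇒m≤o∸n _ total ⟩
      n ∸ common                ≤⟨ ∸-monoʳ-≤ n (geodesic-ball K p K ≤-refl) ⟩
      n ∸ suc K                 ≡⟨ cong (n ∸_) (+-comm 1 K) ⟩
      n ∸ (K + 1)               ≡⟨ sym (∸-+-assoc n K 1) ⟩
      n ∸ K ∸ 1                 ∎
    where
    open ≤-Reasoning
    awayFromU awayFromW nearBoth : Fin n → ℕ
    awayFromU v = ι (adj G w v ∧ atDist G (suc K) u v)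
    awayFromW v = ι (adj G u v ∧ atDist G (suc K) w v)
    nearBoth  v = ι (within G K u v ∧ within G K w v)
    common : ℕ
    common = ∑[ v < n ] nearBoth v
    total : outward u w + outward w u + common ≤ n
    total = begin
        outward u w + outward w u + common
          ≡⟨ cong (_+ common) (sym (∑-distrib-+ awayFromU awayFromW)) ⟩
        ∑[ v < n ] (awayFromU v + awayFromW v) + common
          ≡⟨ sym (∑-distrib-+ (λ v → awayFromU v + awayFromW v) nearBoth) ⟩
        ∑[ v < n ] (awayFromU v + awayFromW v + nearBoth v)
          ≤⟨ sum-mono-≤ (λ v → ι-exclusive₃ (adj G w v ∧ atDist G (suc K) u v)
                 (adj G u v ∧ atDist G (suc K) w v) (within G K u v ∧ within G K w v)
                 (λ a b → at⇒¬near K (second {adj G w v} a) (adj⇒near 1≤K (first b)))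
                 (λ a c → at⇒¬near K (second {adj G w v} a) (first c))
                 (λ b c → at⇒¬near K (second {adj G u v} b) (second c))) ⟩
        ∑[ v < n ] 1
          ≡⟨ sum-ones n ⟩
        n ∎

  ordered-step : 1 ≤ K → 2 * ordered (suc K) ≤ (n ∸ K ∸ 1) * ordered K
  ordered-step 1≤K = begin
      2 * ordered (suc K)
        ≡⟨ cong (ordered (suc K) +_) (+-identityʳ _) ⟩
      ordered (suc K) + ordered (suc K)
        ≤⟨ +-mono-≤ ordered≤outward (≤-trans ordered≤outward (≤-reflexive outward-swap)) ⟩
      overDistK outward + overDistK (λ u w → outward w u)
        ≡⟨ sym (∑-distrib-+ (λ u → ∑[ w < n ] out u w) (λ u → ∑[ w < n ] back u w)) ⟩
      ∑[ u < n ] (∑[ w < n ] out u w + ∑[ w < n ] back u w)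
        ≡⟨ sum-cong-≗ (λ u → sym (∑-distrib-+ (out u) (back u))) ⟩
      ∑[ u < n ] ∑[ w < n ] (out u w + back u w)
        ≤⟨ sum-mono-≤ (λ u → sum-mono-≤ (λ w → ι-weighted (atDist G K u w) c (outward-bound 1≤K))) ⟩
      ∑[ u < n ] ∑[ w < n ] (c * δ u w)
        ≡⟨ sum-cong-≗ (λ u → sym (*-distribˡ-sum c (δ u))) ⟩
      ∑[ u < n ] (c * ∑[ w < n ] δ u w)
        ≡⟨ sym (*-distribˡ-sum c (λ u → ∑[ w < n ] δ u w)) ⟩
      c * ordered K ∎
    where
    open ≤-Reasoning
    c : ℕ
    c = n ∸ K ∸ 1
    δ out back : Fin n → Fin n → ℕ
    δ u w    = ι (atDist G K u w)
    out u w  = δ u w * outward u w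
    back u w = δ u w * outward w u

lemma7 : ∀ (n : ℕ) (G : Graph n) (D : ℕ) → 3 ≤ n → Connected G → HasDiameter G D → 2 ≤ D →
    ∀ (k : ℕ) → 1 ≤ k → k < D → 2 * d (suc k) G ≤ (n ∸ k ∸ 1) * d k G
lemma7 n G D _ _ _ _ k@(suc j) 1≤k _ = *-cancelˡ-≤ 2 (begin
    2 * (2 * d (suc k) G) ≡⟨ cong (2 *_) (sym (ordered≡2*d k)) ⟩
    2 * ordered (suc k)   ≤⟨ ordered-step 1≤k ⟩
    c * ordered k         ≡⟨ cong (c *_) (ordered≡2*d j) ⟩
    c * (2 * d k G)       ≡⟨ x∙yz≈y∙xz c 2 (d k G) ⟩
    2 * (c * d k G)       ∎)
  where
  open Distances G using (ordered; ordered≡2*d)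
  open DoubleCounting G k using (ordered-step)
  open ≤-Reasoning
  c : ℕ
  c = n ∸ k ∸ 1
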